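{- For every formula $A$ of $\mathcal L$, if $A$ is derivable in $\mathsf{MK}$, then $A$ is valid in every minimal birelational model.
   Context: $\mathcal L$ is the language $A ::= p \mid \bot \mid A\wedge A \mid A\vee A \mid A\to A \mid \Box A \mid \Diamond A$ over a countable set $\mathrm{Atm}$ of propositional variables. Minimal propositional logic $\mathsf{MPL}$ is axiomatised by $A\wedge B\to A$, $A\wedge B\to B$, $A\to A\vee B$, $B\to A\vee B$, $(A\to B)\to((A\to C)\to(A\to B\wedge C))$, $(A\to C)\to((B\to C)\to(A\vee B\to C))$, $(A\to(B\to C))\to((A\to B)\to(A\to C))$, $A\to(B\to A)$, and modus ponens. $\mathsf{MK}$ extends $\mathsf{MPL}$ over $\mathcal L$ with the axioms $\Box(A\to B)\to(\Box A\to\Box B)$, $\Box(A\to B)\to(\Diamond A\to\Diamond B)$ and the rule $A/\Box A$. A minimal birelational model is a tuple $\langle W,\le,F,R,V\rangle$ with $W\neq\emptyset$, $\le$ a reflexive transitive relation on $W$, $F\subseteq W$ upward closed under $\le$ (the fallible worlds), $R$ a binary relation on $W$, and $V:\mathrm{Atm}\to\mathcal P(W)$ with each $V(p)$ upward closed under $\le$. Forcing: $w\Vdash p$ iff $w\in V(p)$; $w\Vdash\bot$ iff $w\in F$; $\wedge,\vee$ pointwise; $w\Vdash B\to C$ iff for all $v\ge w$, $v\Vdash B$ implies $v\Vdash C$; $w\Vdash\Box B$ iff for all $v\ge w$ and all $u$ with $vRu$, $u\Vdash B$; $w\Vdash\Diamond B$ iff for all $v\ge w$ there is $u$ with $vRu$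 and $u\Vdash B$. $A$ is valid in a model if it is forced at every world. -}

module Defs where

open import Data.Nat using (ℕ)
open import Data.Product using (_×_; Σ; ∃)
open import Data.Sum using (_⊎_)

Atm : Set
Atm = ℕ

data Fm : Set where
  var  : Atm → Fm
  ⊥'   : Fm
  _∧'_ : Fm → Fm → Fm
  _∨'_ : Fm → Fm → Fm
  _⇒_  : Fm → Fm → Fm
  □    : Fm → Fm
  ◇    : Fm → Fm

infixr 6 _∧'_
infixr 5 _∨'_
infixr 4 _⇒_

data MK⊢ : Fm → Set where
  ax∧₁  : ∀ {A B} → MK⊢ (A ∧' B ⇒ A)
  ax∧₂  : ∀ {A B} → MK⊢ (A ∧' B ⇒ B)
  ax∨₁  : ∀ {A B} → MK⊢ (A ⇒ A ∨' B)
  ax∨₂  : ∀ {A B} → MK⊢ (B ⇒ A ∨' B)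
  ax∧I  : ∀ {A B C} → MK⊢ ((A ⇒ B) ⇒ ((A ⇒ C) ⇒ (A ⇒ B ∧' C)))
  ax∨E  : ∀ {A B C} → MK⊢ ((A ⇒ C) ⇒ ((B ⇒ C) ⇒ (A ∨' B ⇒ C)))
  axS   : ∀ {A B C} → MK⊢ ((A ⇒ (B ⇒ C)) ⇒ ((A ⇒ B) ⇒ (A ⇒ C)))
  axK   : ∀ {A B} → MK⊢ (A ⇒ (B ⇒ A))
  ax□   : ∀ {A B} → MK⊢ (□ (A ⇒ B) ⇒ (□ A ⇒ □ B))
  ax◇   : ∀ {A B} → MK⊢ (□ (A ⇒ B) ⇒ (◇ A ⇒ ◇ B))
  mp    : ∀ {A B} → MK⊢ (A ⇒ B) → MK⊢ A → MK⊢ B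
  nec   : ∀ {A} → MK⊢ A → MK⊢ (□ A)

record Model : Set₁ where
  field
    W      : Set
    inhab  : W
    _≤_    : W → W → Set
    ≤-refl : ∀ w → w ≤ w
    ≤-trans : ∀ {u v w} → u ≤ v → v ≤ w → u ≤ w
    F      : W → Set                 -- fallible worlds
    F-up   : ∀ {w v} → w ≤ v → F w → F v
    R      : W → W → Set
    V      : Atm → W → Set
    V-up   : ∀ p {w v} → w ≤ v → V p w → V p v

open Model public

_,_⊩_ : (M : Model) → W M → Fm → Set
M , w ⊩ var p  = V M p w
M , w ⊩ ⊥'     = F M w
M , w ⊩ (B ∧' C) = (M , w ⊩ B) × (M , w ⊩ C)
M , w ⊩ (B ∨' C) = (M , w ⊩ B) ⊎ (M , w ⊩ C)
M , w ⊩ (B ⇒ C) = ∀ v → _≤_ M w v → M , v ⊩ B → M , v ⊩ C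
M , w ⊩ □ B    = ∀ v → _≤_ M w v → ∀ u → R M v u → M , u ⊩ B
M , w ⊩ ◇ B    = ∀ v → _≤_ M w v → Σ (W M) (λ u → R M v u × (M , u ⊩ B))

Valid : Model → Fm → Set
Valid M A = ∀ w → M , w ⊩ A

{-# OPTIONS --safe #-}
-- Forcing is persistent along ≤, which
-- validates A → (B → A); every other axiom is checked by transporting earlier
-- hypotheses forward along ≤ by transitivity. Minimal logic has no axiom for ⊥,
-- so the fallible worlds only need to be upward closed, like an atom.
module Submission where

open import Defs
open import Data.Product using (_,_)
open import Data.Sum using (inj₁; inj₂)

module _ (M : Model) where

  ⊩-mono : (A : Fm) {w v : W M} → _≤_ M w v → M , w ⊩ A → M , v ⊩ A
  ⊩-mono (var p)  w≤v h          = V-up M p w≤v h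
  ⊩-mono ⊥'       w≤v h          = F-up M w≤v h
  ⊩-mono (A ∧' B) w≤v (a , b)    = ⊩-mono A w≤v a , ⊩-mono B w≤v b
  ⊩-mono (A ∨' B) w≤v (inj₁ a)   = inj₁ (⊩-mono A w≤v a)
  ⊩-mono (A ∨' B) w≤v (inj₂ b)   = inj₂ (⊩-mono B w≤v b)
  ⊩-mono (A ⇒ B)  w≤v h u v≤u    = h u (≤-trans M w≤v v≤u)
  ⊩-mono (□ A)    w≤v h u v≤u    = h u (≤-trans M w≤v v≤u)
  ⊩-mono (◇ A)    w≤v h u v≤u    = h u (≤-trans M w≤v v≤u)

  ⊩-⇒-elim : {A B : Fm} {w : W M} → M , w ⊩ (A ⇒ B) → M , w ⊩ A → M , w ⊩ B
  ⊩-⇒-elim {w = w} h a = h w (≤-refl M w) a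

  sound : {A : Fm} → MK⊢ A → Valid M A
  sound ax∧₁ _ _ _ (a , _) = a
  sound ax∧₂ _ _ _ (_ , b) = b
  sound ax∨₁ _ _ _ a       = inj₁ a
  sound ax∨₂ _ _ _ b       = inj₂ b
  sound ax∧I _ _ _ f _ v≤u g x u≤x a =
    f x (≤-trans M v≤u u≤x) a , g x u≤x a
  sound ax∨E _ _ _ f _ v≤u g x u≤x (inj₁ a) = f x (≤-trans M v≤u u≤x) a
  sound ax∨E _ _ _ f _ v≤u g x u≤x (inj₂ b) = g x u≤x b
  sound (axS {B = B} {C}) _ _ _ f _ v≤u g x u≤x a =
    ⊩-⇒-elim {B} {C} (f x (≤-trans M v≤u u≤x) a) (g x u≤x a)
  sound (axK {A}) _ _ _ a _ v≤u _ = ⊩-mono A v≤u a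
  sound (ax□ {A} {B}) _ _ _ f _ v≤u g x u≤x y xRy =
    ⊩-⇒-elim {A} {B} (f x (≤-trans M v≤u u≤x) y xRy) (g x u≤x y xRy)
  sound (ax◇ {A} {B}) _ _ _ f _ v≤u g x u≤x =
    let (y , xRy , a) = g x u≤x
    in  y , xRy , ⊩-⇒-elim {A} {B} (f x (≤-trans M v≤u u≤x) y xRy) a
  sound (mp {A} {B} d e) w = ⊩-⇒-elim {A} {B} (sound d w) (sound e w)
  sound (nec d) _ _ _ u _ = sound d u

mainTheorem2 : (A : Fm) → MK⊢ A → (M : Model) → Valid M A
mainTheorem2 A d M = sound M d
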